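{- Let $\mathbb{L}$ be a complete lattice, $N\subseteq\mathbb{L}$ a set that meet-generates $\mathbb{L}$, and $f:\mathbb{L}\to\mathbb{L}$ a monotone map. (1) Let $W=\{\mathbf{m}\in N\mid\forall\text{ has a winning strategy in } G^f_{N,\forall} \text{ starting from }\mathbf{m}\}$. Then $\bigwedge W$ is the least fixed point of $f$. (2) Let $W=\{\mathbf{m}\in N\mid\forall\text{ has a winning strategy in } G^f_{N,\exists} \text{ starting from }\mathbf{m}\}$. Then $\bigwedge W$ is the greatest fixed point of $f$.
   Context: The unfolding game board with meet generators: positions are elements $\mathbf{m}\in N$, owned by $\forall$, whose admissible moves are the subsets $S\subseteq N$ with $f(\bigwedge S)\le\mathbf{m}$; and subsets $S\subseteq N$, owned by $\exists$, whose admissible moves are the elements of $S$. A player who must move but has no admissible move loses. In $G^f_{N,\forall}$ all infinite plays are won by $\forall$; in $G^f_{N,\exists}$ all infinite plays are won by $\exists$. A strategy for a player assigns to each partial play ending in one of that player's positions an admissible move; it is winning from a position if every play from that position following it is won by that player. -}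

module Defs where

open import Level using (Level; _⊔_; Lift; Setω) renaming (suc to lsuc)
open import Data.Nat using (ℕ; zero; suc)
open import Data.Product using (Σ; _×_; _,_)
open import Data.Sum using (_⊎_)
open import Data.Maybe using (Maybe; just; nothing; Is-just)
open import Data.Empty using (⊥)
open import Data.Unit.Polymorphic using (⊤)
open import Relation.Nullary using (¬_)
open import Relation.Unary using (Pred; _⊆_)
open import Relation.Binary using (Rel; IsPartialOrder)
open import Relation.Binary.PropositionalEquality using (_≡_; subst)

record CompleteLattice (c ℓ₁ ℓ₂ : Level) : Setω where
  infix 4 _≈_ _≤_
  field
    Carrier        : Set c
    _≈_            : Rel Carrier ℓ₁
    _≤_            : Rel Carrier ℓ₂
    isPartialOrder : IsPartialOrder _≈_ _≤_
    ⋀              : ∀ {a} → Pred Carrier a → Carrier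
    ⋀-lower        : ∀ {a} (P : Pred Carrier a) {x} → P x → ⋀ P ≤ x
    ⋀-greatest     : ∀ {a} (P : Pred Carrier a) {y} →
                     (∀ {x} → P x → y ≤ x) → y ≤ ⋀ P

module _ {c ℓ₁ ℓ₂} (L : CompleteLattice c ℓ₁ ℓ₂) where
  open CompleteLattice L

  MeetGenerates : ∀ {n} → Pred Carrier n → Set (c ⊔ ℓ₁ ⊔ lsuc n)
  MeetGenerates {n} N =
    (x : Carrier) → Σ (Pred Carrier n) λ S → (S ⊆ N) × (x ≈ ⋀ S)

  Monotone : (Carrier → Carrier) → Set (c ⊔ ℓ₂)
  Monotone f = ∀ {x y} → x ≤ y → f x ≤ f y

  IsLeastFixedPoint : (Carrier → Carrier) → Carrier → Set (c ⊔ ℓ₁ ⊔ ℓ₂)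
  IsLeastFixedPoint f x = (f x ≈ x) × (∀ y → f y ≈ y → x ≤ y)

  IsGreatestFixedPoint : (Carrier → Carrier) → Carrier → Set (c ⊔ ℓ₁ ⊔ ℓ₂)
  IsGreatestFixedPoint f x = (f x ≈ x) × (∀ y → f y ≈ y → y ≤ x)

data Player : Set where
  ∀ₚ ∃ₚ : Player

record Game (p m : Level) : Set (lsuc (p ⊔ m)) where
  field
    Pos       : Set p
    owner     : Pos → Player
    Move      : Pos → Pos → Set m
    infWinner : Player

module GameNotions {p m} (G : Game p m) where
  open Game G

  data Play (p₀ : Pos) : Pos → Set (p ⊔ m) where
    start : Play p₀ p₀
    _▸_   : ∀ {q r} → Play p₀ q → Move q r → Play p₀ r

  -- a strategy for player P (from p₀) assigns to partial plays ending in
  -- a position of P an admissible move; it is allowed to be undefined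
  -- (nothing) on plays that do not follow it.
  Strategy : Player → Pos → Set (p ⊔ m)
  Strategy P p₀ = ∀ {q} → Play p₀ q → owner q ≡ P → Maybe (Σ Pos (Move q))

  Follows : ∀ {P p₀} → Strategy P p₀ → ∀ {q} → Play p₀ q → Set (p ⊔ m)
  Follows σ start = ⊤
  Follows {P} σ (_▸_ {q} {r} π mv) =
    Follows σ π × ((e : owner q ≡ P) → σ π e ≡ just (r , mv))

  Stuck : Pos → Set (p ⊔ m)
  Stuck q = ¬ Σ Pos (Move q)

  record InfPlay (p₀ : Pos) : Set (p ⊔ m) where
    field
      pos    : ℕ → Pos
      pos₀   : pos zero ≡ p₀
      move   : ∀ i → Move (pos i) (pos (suc i))

  prefix : ∀ {p₀} (ρ : InfPlay p₀) (i : ℕ) → Play p₀ (InfPlay.pos ρ i)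
  prefix ρ zero    = subst (Play _) (Relation.Binary.PropositionalEquality.sym (InfPlay.pos₀ ρ)) start
  prefix ρ (suc i) = prefix ρ i ▸ InfPlay.move ρ i

  InfFollows : ∀ {P p₀} → Strategy P p₀ → InfPlay p₀ → Set (p ⊔ m)
  InfFollows σ ρ = ∀ i → Follows σ (prefix ρ i)

  Winning : (P : Player) (p₀ : Pos) → Strategy P p₀ → Set (p ⊔ m)
  Winning P p₀ σ =
      (∀ {q} (π : Play p₀ q) → Follows σ π → (e : owner q ≡ P) → Is-just (σ π e))
    × (∀ {q} (π : Play p₀ q) → Follows σ π → Stuck q → ¬ (owner q ≡ P))
    × ((ρ : InfPlay p₀) → InfFollows σ ρ → infWinner ≡ P)

  HasWinningStrategy : Player → Pos → Set (p ⊔ m)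
  HasWinningStrategy P p₀ = Σ (Strategy P p₀) (Winning P p₀)

-- The unfolding game G^f_{N,P} (P = winner of infinite plays).
-- Subsets S ⊆ N are predicates of universe level s.

module Unfolding {c ℓ₁ ℓ₂ n} (L : CompleteLattice c ℓ₁ ℓ₂)
                 (N : Pred (CompleteLattice.Carrier L) n)
                 (f : CompleteLattice.Carrier L → CompleteLattice.Carrier L)
                 (s : Level) where
  open CompleteLattice L

  data UPos : Set (c ⊔ n ⊔ lsuc s) where
    elemPos : (m : Carrier) → N m → UPos
    setPos  : (S : Pred Carrier s) → S ⊆ N → UPos

  uowner : UPos → Player
  uowner (elemPos _ _) = ∀ₚ
  uowner (setPos _ _)  = ∃ₚ

  UMove : UPos → UPos → Set (c ⊔ ℓ₂ ⊔ s)
  UMove (elemPos m _) (setPos S _)  = Lift (c ⊔ ℓ₂ ⊔ s) (f (⋀ S) ≤ m)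
  UMove (setPos S _)  (elemPos x _) = Lift (c ⊔ ℓ₂ ⊔ s) (S x)
  UMove (elemPos _ _) (elemPos _ _) = Lift (c ⊔ ℓ₂ ⊔ s) ⊥
  UMove (setPos _ _)  (setPos _ _)  = Lift (c ⊔ ℓ₂ ⊔ s) ⊥

  G : Player → Game (c ⊔ n ⊔ lsuc s) (c ⊔ ℓ₂ ⊔ s)
  G P = record { Pos = UPos ; owner = uowner ; Move = UMove ; infWinner = P }

  W : Player → Pred Carrier (c ⊔ ℓ₂ ⊔ n ⊔ lsuc s)
  W P m = Σ (N m) λ m∈N →
          GameNotions.HasWinningStrategy (G P) ∀ₚ (elemPos m m∈N)

-- ∀ wins G^f_{N,∀} from m exactly when μf ≤ m: above μf he can always
-- challenge with the generators above μf, and conversely the meet of the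
-- elements reached along a winning strategy is a prefixed point of f.
-- In G^f_{N,∃}, if νf ≰ m then ∃ can keep every position off νf forever,
-- producing an infinite play, so ∀ only wins above νf; conversely the meet
-- w of the elements from which ∀ wins is a postfixed point, because from
-- any generator t ≥ f w he challenges with those elements and then follows
-- the winning strategy of the one ∃ picks.
module Submission where

open import Defs
open import Level using (Level; lift; _⊔_)
open import Axiom.ExcludedMiddle using (ExcludedMiddle)
open import Axiom.DoubleNegationElimination using (em⇒dne)
open import Data.Empty using (⊥-elim)
open import Data.Empty.Polymorphic using (⊥)
open import Data.Maybe using (Maybe; just; nothing; Is-just)
open import Data.Maybe.Relation.Unary.Any using (just)
open import Data.Nat using (ℕ; zero; suc; _+_)
open import Data.Product using (Σ; ∃; _×_; _,_; proj₁; proj₂; uncurry)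
open import Data.Unit.Polymorphic using (⊤; tt)
open import Relation.Nullary using (¬_; Dec; yes; no)
open import Relation.Nullary.Decidable using (True; toWitness; fromWitness)
open import Relation.Unary using (Pred; _⊆_)
open import Relation.Binary using (IsPartialOrder)
open import Relation.Binary.PropositionalEquality using (_≡_; refl; subst; sym; trans; cong)

module CompleteLatticeProperties {c ℓ₁ ℓ₂} (L : CompleteLattice c ℓ₁ ℓ₂) where
  open CompleteLattice L
  open IsPartialOrder isPartialOrder
    renaming (trans to ≤-trans) using (antisym; reflexive; module Eq)

  ≤-by-generators : ∀ {n} {N : Pred Carrier n} → MeetGenerates L N →
                    ∀ {x y} → (∀ {t} → N t → y ≤ t → x ≤ t) → x ≤ y
  ≤-by-generators mg {x} {y} x≤N↑y with mg y
  ... | T , T⊆N , y≈⋀T =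
    ≤-trans (⋀-greatest T λ t∈T →
               x≤N↑y (T⊆N t∈T) (≤-trans (reflexive y≈⋀T) (⋀-lower T t∈T)))
            (reflexive (Eq.sym y≈⋀T))

  ≰⋀⇒∃≰ : (lem : ∀ {a} → ExcludedMiddle a) → ∀ {a} {S : Pred Carrier a} {y} →
          ¬ y ≤ ⋀ S → ∃ λ x → S x × ¬ y ≤ x
  ≰⋀⇒∃≰ lem {S = S} y≰⋀S = em⇒dne lem λ ¬∃ →
    y≰⋀S (⋀-greatest S λ {x} x∈S → em⇒dne lem λ y≰x → ¬∃ (x , x∈S , y≰x))

  module _ {f : Carrier → Carrier} (mono : Monotone L f) where

    f-cong : ∀ {x y} → x ≈ y → f x ≈ f y
    f-cong x≈y = antisym (mono (reflexive x≈y)) (mono (reflexive (Eq.sym x≈y)))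

    lfp : Carrier
    lfp = ⋀ λ x → f x ≤ x

    lfp-least : ∀ {y} → f y ≤ y → lfp ≤ y
    lfp-least = ⋀-lower _

    f-lfp≤lfp : f lfp ≤ lfp
    f-lfp≤lfp = ⋀-greatest _ λ fx≤x → ≤-trans (mono (lfp-least fx≤x)) fx≤x

    lfp-isLeastFixedPoint : IsLeastFixedPoint L f lfp
    lfp-isLeastFixedPoint =
        antisym f-lfp≤lfp (lfp-least (mono f-lfp≤lfp))
      , λ _ fy≈y → lfp-least (reflexive fy≈y)

    -- Only meets are available, so νf is the meet of the upper bounds of
    -- the postfixed points.
    gfp : Carrier
    gfp = ⋀ λ x → ∀ y → y ≤ f y → y ≤ x

    gfp-greatest : ∀ {y} → y ≤ f y → y ≤ gfp
    gfp-greatest {y} y≤fy = ⋀-greatest _ λ ub → ub y y≤fy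

    gfp≤f-gfp : gfp ≤ f gfp
    gfp≤f-gfp = ⋀-lower _ λ y y≤fy → ≤-trans y≤fy (mono (gfp-greatest y≤fy))

    gfp-isGreatestFixedPoint : IsGreatestFixedPoint L f gfp
    gfp-isGreatestFixedPoint =
        antisym (gfp-greatest (mono gfp≤f-gfp)) gfp≤f-gfp
      , λ _ fy≈y → gfp-greatest (reflexive (Eq.sym fy≈y))

    isLeastFixedPoint-resp-≈ : ∀ {x y} → x ≈ y →
                               IsLeastFixedPoint L f x → IsLeastFixedPoint L f y
    isLeastFixedPoint-resp-≈ x≈y (fx≈x , least) =
        Eq.trans (f-cong (Eq.sym x≈y)) (Eq.trans fx≈x x≈y)
      , λ z fz≈z → ≤-trans (reflexive (Eq.sym x≈y)) (least z fz≈z)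

    isGreatestFixedPoint-resp-≈ : ∀ {x y} → x ≈ y →
                                  IsGreatestFixedPoint L f x → IsGreatestFixedPoint L f y
    isGreatestFixedPoint-resp-≈ x≈y (fx≈x , greatest) =
        Eq.trans (f-cong (Eq.sym x≈y)) (Eq.trans fx≈x x≈y)
      , λ z fz≈z → ≤-trans (greatest z fz≈z) (reflexive x≈y)

module Resizing (lem : ∀ {a} → ExcludedMiddle a) where

  record Resized {a b} {A : Set a} (P : Pred A b) (s : Level) (x : A) : Set s where
    constructor resized
    field witness : True (lem {_} {P x})

  resized⁺ : ∀ {a b s} {A : Set a} {P : Pred A b} {x} → P x → Resized P s x
  resized⁺ px = resized (fromWitness px)

  resized⁻ : ∀ {a b s} {A : Set a} {P : Pred A b} {x} → Resized P s x → P x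
  resized⁻ (resized px) = toWitness px

module GameProperties {p m} (G : Game p m) where
  open Game G
  open GameNotions G

  module _ {P : Player} {p₀ : Pos} (σ : Strategy P p₀) where

    Prescribes : ∀ {q r} → Play p₀ q → Move q r → Set (p ⊔ m)
    Prescribes {q} {r} π mv = (e : owner q ≡ P) → σ π e ≡ just (r , mv)

    follows-invariant : ∀ {i} (I : ∀ {q} → Play p₀ q → Set i) → I start →
                        (∀ {q r} (π : Play p₀ q) (mv : Move q r) →
                           Prescribes π mv → I π → I (π ▸ mv)) →
                        ∀ {q} (π : Play p₀ q) → Follows σ π → I π
    follows-invariant I I-start I-step start           _              = I-start
    follows-invariant I I-start I-step (π ▸ mv) (π-follows , mv-prescribed) =
      I-step π mv mv-prescribed (follows-invariant I I-start I-step π π-follows)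

    winning-if-defined :
      (∀ {q} (π : Play p₀ q) → Follows σ π → (e : owner q ≡ P) → Is-just (σ π e)) →
      ((ρ : InfPlay p₀) → InfFollows σ ρ → infWinner ≡ P) → Winning P p₀ σ
    winning-if-defined defined infinite =
        defined
      , (λ π π-follows stuck e → stuck (move-of (defined π π-follows e)))
      , infinite
      where
      move-of : ∀ {q} {a : Maybe (Σ Pos (Move q))} → Is-just a → Σ Pos (Move q)
      move-of (just {x} _) = x

    infinite-play : ∀ {b} (B : Pos → Set b) → B p₀ →
                    (∀ {q} (π : Play p₀ q) → Follows σ π → B q →
                       Σ Pos λ r → Σ (Move q r) λ mv → Prescribes π mv × B r) →
                    Σ (InfPlay p₀) (InfFollows σ)
    infinite-play B B-start B-extend = ρ , λ i → subst (Follows σ) (sym (prefix≡ i)) (follows i)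
      where
      State : Set _
      State = Σ Pos λ q → Σ (Play p₀ q) λ π → Follows σ π × B q

      extend : (st : State) → Σ Pos λ r → Σ (Move (proj₁ st) r) λ mv →
                 Prescribes (proj₁ (proj₂ st)) mv × B r
      extend (q , π , π-follows , Bq) = B-extend π π-follows Bq

      chain : ℕ → State
      chain zero    = p₀ , start , tt , B-start
      chain (suc i) with chain i | extend (chain i)
      ... | q , π , π-follows , _ | r , mv , mv-prescribed , Br =
        r , π ▸ mv , (π-follows , mv-prescribed) , Br

      ρ : InfPlay p₀
      ρ = record { pos  = λ i → proj₁ (chain i)
                 ; pos₀ = refl
                 ; move = λ i → proj₁ (proj₂ (extend (chain i))) }

      follows : ∀ i → Follows σ (proj₁ (proj₂ (chain i)))
      follows i = proj₁ (proj₂ (proj₂ (chain i)))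

      prefix≡ : ∀ i → prefix ρ i ≡ proj₁ (proj₂ (chain i))
      prefix≡ zero    = refl
      prefix≡ (suc i) = cong (_▸ InfPlay.move ρ i) (prefix≡ i)

  suffix : ∀ {p₀} (ρ : InfPlay p₀) (k : ℕ) → InfPlay (InfPlay.pos ρ k)
  suffix ρ k = record { pos  = λ i → InfPlay.pos ρ (i + k)
                      ; pos₀ = refl
                      ; move = λ i → InfPlay.move ρ (i + k) }

  -- A strategy sees only the play, so deciding whether the position after
  -- the opponent's reply is winning is what lets it pick the continuation.
  module Composition {P : Player} (decide : ∀ q → Dec (HasWinningStrategy P q))
                     {p₀ q : Pos} (p₀-owned : owner p₀ ≡ P) (opening : Move p₀ q)
                     (q-unowned : ¬ owner q ≡ P)
                     (continuation : ∀ {r} → Move q r → HasWinningStrategy P r) where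

    data Stage : Pos → Set (p ⊔ m) where
      initial   : Stage p₀
      answering : ∀ {x} → Stage x
      following : ∀ {r x} → HasWinningStrategy P r → Play r x → Stage x
      abandoned : ∀ {x} → Stage x

    advance : ∀ {x y} → Stage x → Move x y → Stage y
    advance initial           _  = answering
    advance {y = y} answering _  with decide y
    ... | yes w = following w start
    ... | no _  = abandoned
    advance (following w π)   mv = following w (π ▸ mv)
    advance abandoned         _  = abandoned

    stage : ∀ {x} → Play p₀ x → Stage x
    stage start    = initial
    stage (π ▸ mv) = advance (stage π) mv

    act : ∀ {x} → Stage x → owner x ≡ P → Maybe (Σ Pos (Move x))
    act initial         _ = just (q , opening)
    act answering       _ = nothing
    act (following w π) e = proj₁ w π e
    act abandoned       _ = nothing

    σ : Strategy P p₀
    σ π = act (stage π)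

    Sound : ∀ {x} → Stage x → Set (p ⊔ m)
    Sound initial         = ⊤
    Sound {x} answering   = ¬ owner x ≡ P × (∀ {r} → Move x r → HasWinningStrategy P r)
    Sound (following w π) = Follows (proj₁ w) π
    Sound abandoned       = ⊥

    entering : ∀ {x y} (mv : Move x y) → Sound (advance answering mv) →
               Σ (HasWinningStrategy P y) λ w → advance answering mv ≡ following w start
    entering {y = y} mv sound with decide y
    ... | yes w = w , refl

    sound-advance : ∀ {x y} (S : Stage x) (mv : Move x y) →
                    (∀ e → act S e ≡ just (y , mv)) → Sound S → Sound (advance S mv)
    sound-advance initial mv prescribed _ with prescribed p₀-owned
    ... | refl = q-unowned , continuation
    sound-advance {y = y} answering mv _ (_ , wins) with decide y
    ... | yes _  = tt
    ... | no ¬wy = ⊥-elim (¬wy (wins mv))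
    sound-advance (following w π) mv prescribed π-follows = π-follows , prescribed

    sound : ∀ {x} (π : Play p₀ x) → Follows σ π → Sound (stage π)
    sound = follows-invariant σ (λ π → Sound (stage π)) tt
              (λ π mv prescribed → sound-advance (stage π) mv prescribed)

    act-defined : ∀ {x} (S : Stage x) → Sound S → (e : owner x ≡ P) → Is-just (act S e)
    act-defined initial         _             _ = just _
    act-defined answering       (unowned , _) e = ⊥-elim (unowned e)
    act-defined (following w π) π-follows     e = proj₁ (proj₂ w) π π-follows e

    answering-after-opening : ∀ {x y} (e : x ≡ p₀) (mv : Move x y) →
                              advance (stage (subst (Play p₀) (sym e) start)) mv ≡ answering
    answering-after-opening refl _ = refl

    infinite-won : (ρ : InfPlay p₀) → InfFollows σ ρ → infWinner ≡ P
    infinite-won ρ ρ-follows = proj₂ (proj₂ (proj₂ w)) (suffix ρ 2) suffix-follows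
      where
      open InfPlay ρ

      stage₁ : stage (prefix ρ 1) ≡ answering
      stage₁ = answering-after-opening pos₀ (move 0)

      entered : Σ (HasWinningStrategy P (pos 2)) λ w → advance answering (move 1) ≡ following w start
      entered = entering (move 1)
        (subst (λ S → Sound (advance S (move 1))) stage₁ (sound (prefix ρ 2) (ρ-follows 2)))

      w : HasWinningStrategy P (pos 2)
      w = proj₁ entered

      stage-suffix : ∀ i → stage (prefix ρ (i + 2)) ≡ following w (prefix (suffix ρ 2) i)
      stage-suffix zero    = trans (cong (λ S → advance S (move 1)) stage₁) (proj₂ entered)
      stage-suffix (suc i) = cong (λ S → advance S (move (i + 2))) (stage-suffix i)

      suffix-follows : InfFollows (proj₁ w) (suffix ρ 2)
      suffix-follows i = subst Sound (stage-suffix i) (sound (prefix ρ (i + 2)) (ρ-follows (i + 2)))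

    winning : HasWinningStrategy P p₀
    winning = σ , winning-if-defined σ
                    (λ π π-follows → act-defined (stage π) (sound π π-follows))
                    infinite-won

module UnfoldingProperties
  (lem : ∀ {a} → ExcludedMiddle a)
  {c ℓ₁ ℓ₂ n : Level} (L : CompleteLattice c ℓ₁ ℓ₂)
  (N : Pred (CompleteLattice.Carrier L) n) (mg : MeetGenerates L N)
  (f : CompleteLattice.Carrier L → CompleteLattice.Carrier L) (mono : Monotone L f)
  (s : Level) where

  open CompleteLattice L
  open IsPartialOrder isPartialOrder
    renaming (trans to ≤-trans) using (antisym; reflexive)
  open CompleteLatticeProperties L
  open Resizing lem
  open Unfolding L N f s
  open GameNotions using (Play; start; _▸_; Follows)

  value : UPos → Carrier
  value (elemPos x _) = x
  value (setPos S _)  = ⋀ S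

  generatorsAbove : Carrier → Pred Carrier s
  generatorsAbove y = Resized (λ z → N z × y ≤ z) s

  generatorsAbove⊆N : ∀ {y} → generatorsAbove y ⊆ N
  generatorsAbove⊆N z∈↑y = proj₁ (resized⁻ z∈↑y)

  ⋀generatorsAbove≤ : ∀ y → ⋀ (generatorsAbove y) ≤ y
  ⋀generatorsAbove≤ y = ≤-by-generators mg λ t∈N y≤t → ⋀-lower _ (resized⁺ (t∈N , y≤t))

  ≤⋀generatorsAbove : ∀ y → y ≤ ⋀ (generatorsAbove y)
  ≤⋀generatorsAbove y = ⋀-greatest _ λ z∈↑y → proj₂ (resized⁻ z∈↑y)

  module ∀-game where
    open GameProperties (G ∀ₚ)

    challenge : (q : UPos) → uowner q ≡ ∀ₚ → Maybe (Σ UPos (UMove q))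
    challenge (elemPos y _) _ with lem {_} {lfp mono ≤ y}
    ... | yes lfp≤y = just ( setPos (generatorsAbove (lfp mono)) generatorsAbove⊆N
                           , lift (≤-trans (mono (⋀generatorsAbove≤ (lfp mono)))
                                           (≤-trans (f-lfp≤lfp mono) lfp≤y)) )
    ... | no _      = nothing

    challenge-stays-above-lfp : ∀ {q r} (mv : UMove q r) →
                                (∀ e → challenge q e ≡ just (r , mv)) →
                                lfp mono ≤ value q → lfp mono ≤ value r
    challenge-stays-above-lfp {elemPos y _} {setPos _ _} _ prescribed _
      with lem {_} {lfp mono ≤ y} | prescribed refl
    ... | yes _ | refl = ≤⋀generatorsAbove (lfp mono)
    challenge-stays-above-lfp {setPos S _} {elemPos _ _} (lift x∈S) _ lfp≤⋀S =
      ≤-trans lfp≤⋀S (⋀-lower S x∈S)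

    challenge-defined : ∀ q → lfp mono ≤ value q → (e : uowner q ≡ ∀ₚ) → Is-just (challenge q e)
    challenge-defined (elemPos y _) lfp≤y _ with lem {_} {lfp mono ≤ y}
    ... | yes _     = just _
    ... | no lfp≰y  = ⊥-elim (lfp≰y lfp≤y)

    winning-above-lfp : ∀ {m} (m∈N : N m) → lfp mono ≤ m → W ∀ₚ m
    winning-above-lfp {m} m∈N lfp≤m = m∈N , σ , winning-if-defined σ
        (λ {q} π π-follows → challenge-defined q (above-lfp π π-follows))
        (λ _ _ → refl)
      where
      σ : GameNotions.Strategy (G ∀ₚ) ∀ₚ (elemPos m m∈N)
      σ {q} _ = challenge q

      above-lfp : ∀ {q} (π : Play (G ∀ₚ) (elemPos m m∈N) q) → Follows (G ∀ₚ) σ π →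
                  lfp mono ≤ value q
      above-lfp = follows-invariant σ (λ {q} _ → lfp mono ≤ value q) lfp≤m
                    (λ _ mv prescribed → challenge-stays-above-lfp mv prescribed)

    -- The elements reached along a winning strategy form a prefixed point.
    W-above-lfp : ∀ {m} → W ∀ₚ m → lfp mono ≤ m
    W-above-lfp {m} (m∈N , σ , defined , _) =
      ≤-trans (lfp-least mono (⋀-greatest Reached f⋀Reached≤))
              (⋀-lower Reached (m∈N , start , tt))
      where
      Reached : Pred Carrier _
      Reached y = Σ (N y) λ y∈N →
                    Σ (Play (G ∀ₚ) (elemPos m m∈N) (elemPos y y∈N)) (Follows (G ∀ₚ) σ)

      f⋀Reached≤ : ∀ {y} → Reached y → f (⋀ Reached) ≤ y
      f⋀Reached≤ (_ , π , π-follows) with σ π refl in eq | defined π π-follows refl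
      ... | just (setPos S S⊆N , lift fS≤y) | _ =
        ≤-trans (mono (⋀-greatest S λ x∈S →
                   ⋀-lower Reached ( S⊆N x∈S
                                   , (π ▸ lift fS≤y) ▸ lift x∈S
                                   , (π-follows , λ { refl → eq }) , λ () )))
                fS≤y
      ... | just (elemPos _ _ , lift ()) | _

    ⋀W≈lfp : ⋀ (W ∀ₚ) ≈ lfp mono
    ⋀W≈lfp = antisym
      (≤-by-generators mg λ t∈N lfp≤t → ⋀-lower (W ∀ₚ) (winning-above-lfp t∈N lfp≤t))
      (⋀-greatest (W ∀ₚ) W-above-lfp)

  module ∃-game where
    open GameProperties (G ∃ₚ)

    W-above-gfp : ∀ {m} → W ∃ₚ m → gfp mono ≤ m
    W-above-gfp {m} (m∈N , σ , defined , _ , infinite-won) = em⇒dne lem λ gfp≰m →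
      ∃ₚ≢∀ₚ (uncurry infinite-won (infinite-play σ (λ q → ¬ gfp mono ≤ value q) gfp≰m escape))
      where
      ∃ₚ≢∀ₚ : ¬ ∃ₚ ≡ ∀ₚ
      ∃ₚ≢∀ₚ ()

      -- ∀ must challenge with some S, and gfp ≤ ⋀ S would give gfp ≤ f gfp
      -- ≤ f (⋀ S) ≤ y; from S, ∃ picks an element not above gfp.
      escape : ∀ {q} (π : Play (G ∃ₚ) (elemPos m m∈N) q) → Follows (G ∃ₚ) σ π →
               ¬ gfp mono ≤ value q →
               Σ UPos λ r → Σ (UMove q r) λ mv → Prescribes σ π mv × ¬ gfp mono ≤ value r
      escape {elemPos y _} π π-follows gfp≰y with σ π refl in eq | defined π π-follows refl
      ... | just (setPos S S⊆N , lift fS≤y) | _ =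
        setPos S S⊆N , lift fS≤y , (λ { refl → eq })
        , λ gfp≤⋀S → gfp≰y (≤-trans (gfp≤f-gfp mono) (≤-trans (mono gfp≤⋀S) fS≤y))
      ... | just (elemPos _ _ , lift ()) | _
      escape {setPos S S⊆N} _ _ gfp≰⋀S with ≰⋀⇒∃≰ lem gfp≰⋀S
      ... | x , x∈S , gfp≰x = elemPos x (S⊆N x∈S) , lift x∈S , (λ ()) , gfp≰x

    -- ∃ may answer with elemPos x x∈N for any proof x∈N, so winning must not
    -- depend on it.
    WinsFromEvery : Pred Carrier _
    WinsFromEvery x =
      N x × (∀ (x∈N : N x) → GameNotions.HasWinningStrategy (G ∃ₚ) ∀ₚ (elemPos x x∈N))

    ⋀WinsFromEvery-postfixed : ⋀ WinsFromEvery ≤ f (⋀ WinsFromEvery)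
    ⋀WinsFromEvery-postfixed = ≤-by-generators mg λ t∈N fw≤t →
      ⋀-lower WinsFromEvery (t∈N , λ t∈N′ → winning-from t∈N′ fw≤t)
      where
      Winners : Pred Carrier s
      Winners = Resized WinsFromEvery s

      Winners⊆N : Winners ⊆ N
      Winners⊆N w = proj₁ (resized⁻ w)

      winning-from : ∀ {t} (t∈N : N t) → f (⋀ WinsFromEvery) ≤ t →
                     GameNotions.HasWinningStrategy (G ∃ₚ) ∀ₚ (elemPos t t∈N)
      winning-from t∈N fw≤t =
        Composition.winning (λ _ → lem) {q = setPos Winners Winners⊆N} refl
          (lift (≤-trans (mono (⋀-greatest WinsFromEvery λ w → ⋀-lower Winners (resized⁺ w))) fw≤t))
          (λ ())
          λ { {elemPos x x∈N} (lift x∈Winners) → proj₂ (resized⁻ x∈Winners) x∈N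
            ; {setPos _ _} (lift ()) }

    ⋀W≈gfp : ⋀ (W ∃ₚ) ≈ gfp mono
    ⋀W≈gfp = antisym
      (≤-trans (⋀-greatest WinsFromEvery λ (x∈N , wins) → ⋀-lower (W ∃ₚ) (x∈N , wins x∈N))
               (gfp-greatest mono ⋀WinsFromEvery-postfixed))
      (⋀-greatest (W ∃ₚ) W-above-gfp)

lemma3 : (lem : ∀ {a} → ExcludedMiddle a)
    {c ℓ₁ ℓ₂ n : Level} (L : CompleteLattice c ℓ₁ ℓ₂)
    (N : Pred (CompleteLattice.Carrier L) n) → MeetGenerates L N →
    (f : CompleteLattice.Carrier L → CompleteLattice.Carrier L) → Monotone L f →
    (s : Level) →
    IsLeastFixedPoint L f (CompleteLattice.⋀ L (Unfolding.W L N f s ∀ₚ))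
    × IsGreatestFixedPoint L f (CompleteLattice.⋀ L (Unfolding.W L N f s ∃ₚ))
lemma3 lem L N mg f mono s =
    isLeastFixedPoint-resp-≈ mono (Eq.sym ∀-game.⋀W≈lfp) (lfp-isLeastFixedPoint mono)
  , isGreatestFixedPoint-resp-≈ mono (Eq.sym ∃-game.⋀W≈gfp) (gfp-isGreatestFixedPoint mono)
  where
  open CompleteLatticeProperties L
  open UnfoldingProperties lem L N mg f mono s
  open IsPartialOrder (CompleteLattice.isPartialOrder L) using (module Eq)
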